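{- Let $\ell$ be a positive integer, let $\sigma,\sigma':[\ell]\to[\ell]$ be permutations, and let $(P_\sigma,(x_1,\dots,x_\ell),(y_1,\dots,y_\ell),L)$ and $(P_{\sigma'},(x'_1,\dots,x'_\ell),(y'_1,\dots,y'_\ell),L')$ be permutation gadgets for $\sigma$ and $\sigma'$ respectively, on disjoint vertex sets. Let $P$ be obtained by chaining $P_\sigma$ with $P_{\sigma'}$: identify $y_i$ with $x'_i$ for each $i\in[\ell]$, order all vertices of $P_\sigma$ before the remaining vertices of $P_{\sigma'}$ (each part in its own order), and take the union of the list functions. Then $(P,(x_1,\dots,x_\ell),(y'_1,\dots,y'_\ell),L\cup L')$ is a permutation gadget for $\sigma'\circ\sigma$.
   Context: An ordered graph is a finite simple graph with a fixed linear order of its vertices. $M$ is the ordered graph on $v_1\prec v_2\prec v_3\prec v_4$ with exactly the edges $v_1v_4,v_2v_3$; $M$-free means no induced order-preserving copy of $M$. For positive integers $\ell,\ell'$, a link is a tuple $(F,(x_1,\ldots,x_\ell),(y_1,\ldots,y_{\ell'}))$ with $F$ an ordered graph such that $x_1,\dots,x_\ell$ are in this order the first $\ell$ vertices of $F$, $y_1,\dots,y_{\ell'}$ are in this order the last $\ell'$ vertices, the sets $\{x_i\}$ and $\{y_j\}$ are disjoint and independent, and $F$ is $M$-free. A coloring of $(P,L)$, for $L:V(P)\to 2^{[4]}$, is a proper coloring $f$ with $f(v)\in L(v)$ for all $v$. A permutation gadget for a permutation $\sigma$ of $[\ell]$ is a tuple $(P_\sigma,(x_1,\ldots,x_\ell),(y_1,\ldots,y_\ell),L)$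 where the first three entries form a link and $L:V(P_\sigma)\to 2^{[4]}$ satisfies: (P1) $L(x_i)=L(y_i)=\{1,2\}$ for all $i$; (P2) every $f:\{x_1,\dots,x_\ell\}\to\{1,2\}$ extends to a coloring of $(P_\sigma,L)$; (P3) every coloring $f$ of $(P_\sigma,L)$ satisfies $f(x_i)=f(y_{\sigma(i)})$ for all $i$. -}

module Defs where

open import Data.Nat using (ℕ; zero; suc; _+_; _∸_; _≤_; _<_; _<ᵇ_; _≤ᵇ_)
open import Data.Bool using (Bool; true; false; _∧_; _∨_; if_then_else_)
open import Data.Fin using (Fin; toℕ)
open import Data.Fin.Subset using (Subset; _∈_; inside; outside)
open import Data.Fin.Permutation using (Permutation′; _⟨$⟩ʳ_)
open import Data.Vec using (_∷_; [])
open import Data.Product using (Σ; _×_; _,_)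
open import Relation.Nullary using (¬_)
open import Relation.Binary.PropositionalEquality using (_≡_; _≢_)

-- An ordered graph on the vertex set {0, 1, ..., size - 1}, ordered by the
-- natural order of ℕ.
record OGraph : Set where
  constructor ograph
  field
    size : ℕ
    adj  : ℕ → ℕ → Bool
open OGraph public

Edge : OGraph → ℕ → ℕ → Set
Edge G u v = adj G u v ≡ true

NonEdge : OGraph → ℕ → ℕ → Set
NonEdge G u v = adj G u v ≡ false

record WF (G : OGraph) : Set where
  field
    symmetric : ∀ u v → adj G u v ≡ adj G v u
    loopless  : ∀ v → adj G v v ≡ false
    inRange   : ∀ u v → Edge G u v → u < size G × v < size G

MFree : OGraph → Set
MFree G = ∀ a b c d → a < b → b < c → c < d → d < size G →
  ¬ (Edge G a d × Edge G b c × NonEdge G a b × NonEdge G a c ×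
     NonEdge G b d × NonEdge G c d)

-- x_i (i = 0..ℓ-1, 0-based) is the i-th vertex; y_j the j-th of the last ℓ' vertices
xv : {ℓ : ℕ} → Fin ℓ → ℕ
xv i = toℕ i

yv : (G : OGraph) (ℓ' : ℕ) → Fin ℓ' → ℕ
yv G ℓ' j = (size G ∸ ℓ') + toℕ j

record Link (G : OGraph) (ℓ ℓ' : ℕ) : Set where
  field
    ℓ-pos      : 0 < ℓ
    ℓ'-pos     : 0 < ℓ'
    wf         : WF G
    disjoint   : ℓ + ℓ' ≤ size G
    x-indep    : ∀ (i j : Fin ℓ) → NonEdge G (xv i) (xv j)
    y-indep    : ∀ (i j : Fin ℓ') → NonEdge G (yv G ℓ' i) (yv G ℓ' j)
    mfree      : MFree G

-- lists: subsets of [4] = {1,2,3,4}, colour k represented by Fin index k-1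
Lists : Set
Lists = ℕ → Subset 4

L12 : Subset 4
L12 = inside ∷ inside ∷ outside ∷ outside ∷ []

IsColoring : OGraph → Lists → (ℕ → Fin 4) → Set
IsColoring G L f =
  (∀ v → v < size G → f v ∈ L v) × (∀ u v → Edge G u v → f u ≢ f v)

record PermGadget {ℓ : ℕ} (σ : Permutation′ ℓ) (G : OGraph) (L : Lists) : Set where
  field
    link : Link G ℓ ℓ
    P1   : ∀ (i : Fin ℓ) → (L (xv i) ≡ L12) × (L (yv G ℓ i) ≡ L12)
    P2   : ∀ (g : Fin ℓ → Fin 4) → (∀ i → g i ∈ L12) →
           Σ (ℕ → Fin 4) λ f → IsColoring G L f × (∀ i → f (xv i) ≡ g i)
    P3   : ∀ (f : ℕ → Fin 4) → IsColoring G L f →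
           ∀ (i : Fin ℓ) → f (xv i) ≡ f (yv G ℓ (σ ⟨$⟩ʳ i))

-- Chaining: vertex k of G' becomes vertex (size G ∸ ℓ) + k of the chain, so
-- y_i = vertex size G - ℓ + i of G is identified with x'_i = vertex i of G',
-- all vertices of G come first (in their order), then the remaining vertices
-- of G' (in their order).
offset : OGraph → ℕ → ℕ
offset G ℓ = size G ∸ ℓ

chain : ℕ → OGraph → OGraph → OGraph
chain ℓ G G' = ograph (size G + size G' ∸ ℓ) a
  where
  o = offset G ℓ
  a : ℕ → ℕ → Bool
  a u v = ((u <ᵇ size G) ∧ (v <ᵇ size G) ∧ adj G u v)
        ∨ ((o ≤ᵇ u) ∧ (o ≤ᵇ v) ∧ adj G' (u ∸ o) (v ∸ o))

-- union of the list functions (they agree on identified vertices, both {1,2})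
chainL : ℕ → OGraph → Lists → Lists → Lists
chainL ℓ G L L' v = if v <ᵇ size G then L v else L' (v ∸ offset G ℓ)

module Submission where

-- Chaining glues G and G' along the ℓ identified vertices, which are independent
-- on both sides. An induced copy of M in the chain with its outer edge in one part
-- and its inner edge in the other would have both inner vertices nested among the
-- identified ones, so that inner edge would join two independent vertices. A list
-- colouring of the chain is the same as a pair of list colourings of G and G' that
-- agree on the identified vertices: (P2) extends a colouring of the x_i through G
-- and then through G' from the colours of the y_i, and (P3) composes the two
-- transfers x_i ↦ y_σ(i) = x'_σ(i) ↦ y'_σ'(σ(i)).

open import Defs
open import Algebra.Bundles using (CommutativeMonoid)
open import Data.Bool using (true; false; T; _∧_; _∨_; if_then_else_)
open import Data.Bool.Properties
  using (T-≡; T-∧; T-∨; ∧-zeroʳ; ¬-not; not-¬; ∧-commutativeMonoid)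
open import Data.Fin using (Fin; toℕ; fromℕ<)
open import Data.Fin.Properties using (toℕ<n; toℕ-fromℕ<)
open import Data.Fin.Permutation using (Permutation′; _∘ₚ_; _⟨$⟩ʳ_)
open import Data.Fin.Subset using (_∈_)
open import Data.Nat using (ℕ; _+_; _∸_; _≤_; _<_; _<ᵇ_; _≤ᵇ_; z≤n)
open import Data.Nat.Properties
open import Data.Product using (Σ; _×_; _,_; proj₁; proj₂)
open import Data.Sum using (_⊎_; inj₁; inj₂; [_,_])
import Data.Sum as Sum
open import Function using (_∘_; Equivalence)
open import Relation.Nullary using (¬_; yes; no)
open import Relation.Binary.PropositionalEquality
  using (_≡_; _≢_; refl; sym; trans; cong; cong₂; subst; subst₂; module ≡-Reasoning)
open import Algebra.Properties.CommutativeSemigroup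
  (CommutativeMonoid.commutativeSemigroup ∧-commutativeMonoid) using (x∙yz≈y∙xz)

open Equivalence using (to; from)

T-∧₃ : ∀ {a b c} → T (a ∧ b ∧ c) → T a × T b × T c
T-∧₃ t = let ta , tbc = to T-∧ t in ta , to T-∧ tbc

T-∧₃⁻ : ∀ {a b c} → T a → T b → T c → T (a ∧ b ∧ c)
T-∧₃⁻ ta tb tc = from T-∧ (ta , from T-∧ (tb , tc))

≡false⇒≢true : ∀ {b} → b ≡ false → b ≢ true
≡false⇒≢true b≡false b≡true = not-¬ b≡true b≡false

≢true⇒≡false : ∀ {b} → b ≢ true → b ≡ false
≢true⇒≡false = ¬-not

∸-offset-< : ∀ {o k u} → o ≤ u → u < o + k → u ∸ o < k
∸-offset-< {o} {k} o≤u u<o+k = subst (_ <_) (m+n∸m≡n o k) (∸-monoˡ-< u<o+k o≤u)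

offset-index : ∀ {o k u} → o ≤ u → u < o + k → Σ (Fin k) λ i → o + toℕ i ≡ u
offset-index {o} o≤u u<o+k =
  fromℕ< (∸-offset-< o≤u u<o+k) ,
  trans (cong (o +_) (toℕ-fromℕ< _)) (m+[n∸m]≡n o≤u)

module LinkProperties {G : OGraph} {ℓ ℓ' : ℕ} (link : Link G ℓ ℓ') where
  open Link link public

  ℓ≤size : ℓ ≤ size G
  ℓ≤size = m+n≤o⇒m≤o ℓ disjoint

  ℓ'≤size : ℓ' ≤ size G
  ℓ'≤size = m+n≤o⇒n≤o ℓ disjoint

  size≡offset+ℓ' : size G ≡ offset G ℓ' + ℓ'
  size≡offset+ℓ' = sym (m∸n+n≡m ℓ'≤size)

  xv<size : (i : Fin ℓ) → xv i < size G
  xv<size i = <-≤-trans (toℕ<n i) ℓ≤size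

  yv<size : (i : Fin ℓ') → yv G ℓ' i < size G
  yv<size i = subst (yv G ℓ' i <_) (sym size≡offset+ℓ') (+-monoʳ-< (offset G ℓ') (toℕ<n i))

  x-nonEdge : ∀ {u v} → u < ℓ → v < ℓ → NonEdge G u v
  x-nonEdge u<ℓ v<ℓ with offset-index z≤n u<ℓ | offset-index z≤n v<ℓ
  ... | i , refl | j , refl = x-indep i j

  y-nonEdge : ∀ {u v} → offset G ℓ' ≤ u → u < size G → offset G ℓ' ≤ v → v < size G →
              NonEdge G u v
  y-nonEdge o≤u u<s o≤v v<s
    with offset-index o≤u (subst (_ <_) size≡offset+ℓ' u<s)
       | offset-index o≤v (subst (_ <_) size≡offset+ℓ' v<s)
  ... | i , refl | j , refl = y-indep i j

module Chain (m : ℕ) (G G' : OGraph) (m≤size : m ≤ size G) (m≤size' : m ≤ size G') where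

  o : ℕ
  o = offset G m

  C : OGraph
  C = chain m G G'

  offset+m≡size : o + m ≡ size G
  offset+m≡size = m∸n+n≡m m≤size

  offset≤size : o ≤ size G
  offset≤size = m∸n≤m (size G) m

  size-chain : size C ≡ o + size G'
  size-chain = +-∸-comm (size G') m≤size

  size≤size-chain : size G ≤ size C
  size≤size-chain = subst₂ _≤_ offset+m≡size (sym size-chain) (+-monoʳ-≤ o m≤size')

  offset+<size-chain : ∀ {v} → v < size G' → o + v < size C
  offset+<size-chain {v} v<s' = subst (o + v <_) (sym size-chain) (+-monoʳ-< o v<s')

  ∸-offset<size' : ∀ {v} → o ≤ v → v < size C → v ∸ o < size G'
  ∸-offset<size' {v} o≤v v<N = ∸-offset-< o≤v (subst (v <_) size-chain v<N)

  ∸-offset<m : ∀ {v} → o ≤ v → v < size G → v ∸ o < m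
  ∸-offset<m o≤v v<s = ∸-offset-< o≤v (subst (_ <_) (sym offset+m≡size) v<s)

  yv-chain : ∀ {n} → n ≤ size G' → (i : Fin n) → yv C n i ≡ o + yv G' n i
  yv-chain {n} n≤size' i = begin
    size C ∸ n + toℕ i          ≡⟨ cong (λ k → k ∸ n + toℕ i) size-chain ⟩
    o + size G' ∸ n + toℕ i     ≡⟨ cong (_+ toℕ i) (+-∸-assoc o n≤size') ⟩
    o + (size G' ∸ n) + toℕ i   ≡⟨ +-assoc o (size G' ∸ n) (toℕ i) ⟩
    o + yv G' n i               ∎
    where open ≡-Reasoning

  LeftEdge RightEdge : ℕ → ℕ → Set
  LeftEdge u v = u < size G × v < size G × Edge G u v
  RightEdge u v = o ≤ u × o ≤ v × Edge G' (u ∸ o) (v ∸ o)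

  edge-cases : ∀ {u v} → Edge C u v → LeftEdge u v ⊎ RightEdge u v
  edge-cases {u} {v} e = Sum.map left right (to T-∨ (from T-≡ e))
    where
    left : T ((u <ᵇ size G) ∧ (v <ᵇ size G) ∧ adj G u v) → LeftEdge u v
    left t = let tu , tv , tuv = T-∧₃ t in <ᵇ⇒< u _ tu , <ᵇ⇒< v _ tv , to T-≡ tuv
    right : T ((o ≤ᵇ u) ∧ (o ≤ᵇ v) ∧ adj G' (u ∸ o) (v ∸ o)) → RightEdge u v
    right t = let tu , tv , tuv = T-∧₃ t in ≤ᵇ⇒≤ o u tu , ≤ᵇ⇒≤ o v tv , to T-≡ tuv

  leftEdge⇒edge : ∀ {u v} → LeftEdge u v → Edge C u v
  leftEdge⇒edge (u<s , v<s , e) =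
    to T-≡ (from T-∨ (inj₁ (T-∧₃⁻ (<⇒<ᵇ u<s) (<⇒<ᵇ v<s) (from T-≡ e))))

  rightEdge⇒edge : ∀ {u v} → RightEdge u v → Edge C u v
  rightEdge⇒edge (o≤u , o≤v , e) =
    to T-≡ (from T-∨ (inj₂ (T-∧₃⁻ (≤⇒≤ᵇ o≤u) (≤⇒≤ᵇ o≤v) (from T-≡ e))))

  edge-left : WF G → ∀ {u v} → Edge G u v → Edge C u v
  edge-left wf {u} {v} e =
    let u<s , v<s = WF.inRange wf u v e in leftEdge⇒edge (u<s , v<s , e)

  edge-shift : ∀ {u v} → Edge G' u v → Edge C (o + u) (o + v)
  edge-shift {u} {v} e = rightEdge⇒edge
    (m≤m+n o u , m≤m+n o v , subst₂ (Edge G') (sym (m+n∸m≡n o u)) (sym (m+n∸m≡n o v)) e)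

  nonEdge-left : WF G → ∀ {u v} → NonEdge C u v → NonEdge G u v
  nonEdge-left wf n = ≢true⇒≡false (≡false⇒≢true n ∘ edge-left wf)

  nonEdge-right : ∀ {u v} → o ≤ u → o ≤ v → NonEdge C u v → NonEdge G' (u ∸ o) (v ∸ o)
  nonEdge-right o≤u o≤v n =
    ≢true⇒≡false (λ e → ≡false⇒≢true n (rightEdge⇒edge (o≤u , o≤v , e)))

  nonEdge-shift : ∀ {u v} → m ≤ u → NonEdge G' u v → NonEdge C (o + u) (o + v)
  nonEdge-shift {u} {v} m≤u n = ≢true⇒≡false ([ outsideG , inG' ] ∘ edge-cases)
    where
    outsideG : ¬ LeftEdge (o + u) (o + v)
    outsideG (o+u<s , _) = <⇒≱ o+u<s (subst (_≤ o + u) offset+m≡size (+-monoʳ-≤ o m≤u))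
    inG' : ¬ RightEdge (o + u) (o + v)
    inG' (_ , _ , e) = ≡false⇒≢true n (subst₂ (Edge G') (m+n∸m≡n o u) (m+n∸m≡n o v) e)

  chain-wf : WF G → WF G' → WF C
  chain-wf wf wf' = record { symmetric = symmetric ; loopless = loopless ; inRange = inRange }
    where
    exchange : ∀ a b {c d} → c ≡ d → a ∧ b ∧ c ≡ b ∧ a ∧ d
    exchange a b {c} refl = x∙yz≈y∙xz a b c

    diagonal : ∀ a {c} → c ≡ false → a ∧ a ∧ c ≡ false
    diagonal a refl = trans (cong (a ∧_) (∧-zeroʳ a)) (∧-zeroʳ a)

    symmetric : ∀ u v → adj C u v ≡ adj C v u
    symmetric u v =
      cong₂ _∨_ (exchange (u <ᵇ size G) (v <ᵇ size G) (WF.symmetric wf u v))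
                (exchange (o ≤ᵇ u) (o ≤ᵇ v) (WF.symmetric wf' (u ∸ o) (v ∸ o)))

    loopless : ∀ v → adj C v v ≡ false
    loopless v = cong₂ _∨_ (diagonal (v <ᵇ size G) (WF.loopless wf v))
                           (diagonal (o ≤ᵇ v) (WF.loopless wf' (v ∸ o)))

    unshift : ∀ {v} → o ≤ v → v ∸ o < size G' → v < size C
    unshift o≤v v'<s' = subst (_< size C) (m+[n∸m]≡n o≤v) (offset+<size-chain v'<s')

    inRange : ∀ u v → Edge C u v → u < size C × v < size C
    inRange u v e with edge-cases e
    ... | inj₁ (u<s , v<s , _) =
      <-≤-trans u<s size≤size-chain , <-≤-trans v<s size≤size-chain
    ... | inj₂ (o≤u , o≤v , e') =
      let u'<s' , v'<s' = WF.inRange wf' _ _ e' in unshift o≤u u'<s' , unshift o≤v v'<s'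

  module _ {ℓ n : ℕ} (link : Link G ℓ m) (link' : Link G' m n) where
    private
      module A = LinkProperties link
      module B = LinkProperties link'

    chain-mfree : MFree C
    chain-mfree a b c d a<b b<c c<d d<N (ad , bc , ab , ac , bd , cd)
      with edge-cases ad | edge-cases bc
    ... | inj₁ (_ , d<s , adG) | inj₁ (_ , _ , bcG) =
      A.mfree a b c d a<b b<c c<d d<s
        (adG , bcG , nonEdge-left A.wf ab , nonEdge-left A.wf ac ,
         nonEdge-left A.wf bd , nonEdge-left A.wf cd)
    ... | inj₁ (_ , d<s , _) | inj₂ (o≤b , o≤c , bcG') =
      ≡false⇒≢true (B.x-nonEdge (∸-offset<m o≤b b<s) (∸-offset<m o≤c c<s)) bcG'
      where
      c<s : c < size G
      c<s = <-trans c<d d<s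
      b<s : b < size G
      b<s = <-trans b<c c<s
    ... | inj₂ (o≤a , _ , _) | inj₁ (b<s , c<s , bcG) =
      ≡false⇒≢true (A.y-nonEdge o≤b b<s o≤c c<s) bcG
      where
      o≤b : o ≤ b
      o≤b = ≤-trans o≤a (<⇒≤ a<b)
      o≤c : o ≤ c
      o≤c = ≤-trans o≤b (<⇒≤ b<c)
    ... | inj₂ (o≤a , o≤d , adG') | inj₂ (o≤b , o≤c , bcG') =
      B.mfree (a ∸ o) (b ∸ o) (c ∸ o) (d ∸ o)
        (∸-monoˡ-< a<b o≤a) (∸-monoˡ-< b<c o≤b) (∸-monoˡ-< c<d o≤c)
        (∸-offset<size' o≤d d<N)
        (adG' , bcG' , nonEdge-right o≤a o≤b ab , nonEdge-right o≤a o≤c ac ,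
         nonEdge-right o≤b o≤d bd , nonEdge-right o≤c o≤d cd)

    chain-link : Link C ℓ n
    chain-link = record
      { ℓ-pos = A.ℓ-pos ; ℓ'-pos = B.ℓ'-pos ; wf = chain-wf A.wf B.wf
      ; disjoint = subst (ℓ + n ≤_) (sym size-chain) (+-mono-≤ ℓ≤o B.ℓ'≤size)
      ; x-indep = chain-x-indep ; y-indep = chain-y-indep ; mfree = chain-mfree }
      where
      ℓ≤o : ℓ ≤ o
      ℓ≤o = m+n≤o⇒m≤o∸n ℓ A.disjoint

      chain-x-indep : ∀ (i j : Fin ℓ) → NonEdge C (xv i) (xv j)
      chain-x-indep i j = ≢true⇒≡false ([ inG , outsideG' ] ∘ edge-cases)
        where
        inG : ¬ LeftEdge (xv i) (xv j)
        inG (_ , _ , e) = ≡false⇒≢true (A.x-indep i j) e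
        outsideG' : ¬ RightEdge (xv i) (xv j)
        outsideG' (o≤x , _) = <⇒≱ (<-≤-trans (toℕ<n i) ℓ≤o) o≤x

      chain-y-indep : ∀ (i j : Fin n) → NonEdge C (yv C n i) (yv C n j)
      chain-y-indep i j =
        subst₂ (NonEdge C) (sym (yv-chain B.ℓ'≤size i)) (sym (yv-chain B.ℓ'≤size j))
          (nonEdge-shift (≤-trans (m+n≤o⇒m≤o∸n m B.disjoint) (m≤m+n _ (toℕ i)))
            (B.y-indep i j))

  -- chainL m G L L' is definitionally splice L L'; splice also glues colourings.
  splice : {A : Set} → (ℕ → A) → (ℕ → A) → ℕ → A
  splice h h' v = if v <ᵇ size G then h v else h' (v ∸ o)

  OverlapAgrees : {A : Set} → (ℕ → A) → (ℕ → A) → Set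
  OverlapAgrees h h' = ∀ (i : Fin m) → h (yv G m i) ≡ h' (xv i)

  module _ {A : Set} (h h' : ℕ → A) where

    splice-left : ∀ {v} → v < size G → splice h h' v ≡ h v
    splice-left v<s rewrite to T-≡ (<⇒<ᵇ v<s) = refl

    splice-right : OverlapAgrees h h' → ∀ {v} → o ≤ v → splice h h' v ≡ h' (v ∸ o)
    splice-right agree {v} o≤v with v <ᵇ size G in eq
    ... | false = refl
    ... | true  = begin
      h v              ≡⟨ cong h (sym (m+[n∸m]≡n o≤v)) ⟩
      h (o + (v ∸ o))  ≡⟨ subst (λ k → h (o + k) ≡ h' k) (toℕ-fromℕ< v∸o<m)
                                 (agree (fromℕ< v∸o<m)) ⟩
      h' (v ∸ o)       ∎
      where
      open ≡-Reasoning
      v∸o<m : v ∸ o < m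
      v∸o<m = ∸-offset<m o≤v (<ᵇ⇒< v _ (from T-≡ eq))

    splice-shift : OverlapAgrees h h' → ∀ v → splice h h' (o + v) ≡ h' v
    splice-shift agree v = trans (splice-right agree (m≤m+n o v)) (cong h' (m+n∸m≡n o v))

  coloring-left : ∀ {L L' f} → WF G → IsColoring C (splice L L') f → IsColoring G L f
  coloring-left {L} {L'} wf (colors , proper) =
    (λ v v<s → subst (_ ∈_) (splice-left L L' v<s)
                 (colors v (<-≤-trans v<s size≤size-chain))) ,
    (λ u v e → proper u v (edge-left wf e))

  coloring-shift : ∀ {L L' f} → OverlapAgrees L L' →
                   IsColoring C (splice L L') f → IsColoring G' L' (f ∘ (o +_))
  coloring-shift {L} {L'} agree (colors , proper) =
    (λ v v<s' → subst (_ ∈_) (splice-shift L L' agree v)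
                  (colors (o + v) (offset+<size-chain v<s'))) ,
    (λ u v e → proper (o + u) (o + v) (edge-shift e))

  splice-coloring : ∀ {L L' f f'} → OverlapAgrees L L' → OverlapAgrees f f' →
                    IsColoring G L f → IsColoring G' L' f' →
                    IsColoring C (splice L L') (splice f f')
  splice-coloring {L} {L'} {f} {f'} agreeL agreeF (colors , proper) (colors' , proper') =
    colorsC , properC
    where
    colorsC : ∀ v → v < size C → splice f f' v ∈ splice L L' v
    colorsC v v<N with v <? size G
    ... | yes v<s =
      subst₂ _∈_ (sym (splice-left f f' v<s)) (sym (splice-left L L' v<s)) (colors v v<s)
    ... | no v≮s =
      subst₂ _∈_ (sym (splice-right f f' agreeF o≤v)) (sym (splice-right L L' agreeL o≤v))
        (colors' (v ∸ o) (∸-offset<size' o≤v v<N))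
      where
      o≤v : o ≤ v
      o≤v = ≤-trans offset≤size (≮⇒≥ v≮s)

    properC : ∀ u v → Edge C u v → splice f f' u ≢ splice f f' v
    properC u v e with edge-cases e
    ... | inj₁ (u<s , v<s , eG) = λ eq →
      proper u v eG (trans (sym (splice-left f f' u<s)) (trans eq (splice-left f f' v<s)))
    ... | inj₂ (o≤u , o≤v , eG') = λ eq →
      proper' _ _ eG'
        (trans (sym (splice-right f f' agreeF o≤u)) (trans eq (splice-right f f' agreeF o≤v)))

module ChainGadget {ℓ : ℕ} {σ σ' : Permutation′ ℓ} {G G' : OGraph} {L L' : Lists}
                   (gadget : PermGadget σ G L) (gadget' : PermGadget σ' G' L') where
  private
    module A = PermGadget gadget
    module B = PermGadget gadget'
    module LA = LinkProperties A.link
    module LB = LinkProperties B.link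

  open Chain ℓ G G' LA.ℓ'≤size LB.ℓ≤size public

  lists-agree : OverlapAgrees L L'
  lists-agree i = trans (proj₂ (A.P1 i)) (sym (proj₁ (B.P1 i)))

  chain-P1 : ∀ (i : Fin ℓ) → (splice L L' (xv i) ≡ L12) × (splice L L' (yv C ℓ i) ≡ L12)
  chain-P1 i = trans (splice-left L L' (LA.xv<size i)) (proj₁ (A.P1 i)) , (begin
    splice L L' (yv C ℓ i)        ≡⟨ cong (splice L L') (yv-chain LB.ℓ'≤size i) ⟩
    splice L L' (o + yv G' ℓ i)   ≡⟨ splice-shift L L' lists-agree (yv G' ℓ i) ⟩
    L' (yv G' ℓ i)                ≡⟨ proj₂ (B.P1 i) ⟩
    L12                           ∎)
    where open ≡-Reasoning

  chain-P2 : ∀ (g : Fin ℓ → Fin 4) → (∀ i → g i ∈ L12) →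
             Σ (ℕ → Fin 4) λ f → IsColoring C (splice L L') f × (∀ i → f (xv i) ≡ g i)
  chain-P2 g g∈L12 with A.P2 g g∈L12
  ... | f , coloring , f-x with B.P2 (f ∘ yv G ℓ) y∈L12
    where
    y∈L12 : ∀ i → f (yv G ℓ i) ∈ L12
    y∈L12 i = subst (_ ∈_) (proj₂ (A.P1 i)) (proj₁ coloring (yv G ℓ i) (LA.yv<size i))
  ... | f' , coloring' , f'-x =
    splice f f' ,
    splice-coloring lists-agree (sym ∘ f'-x) coloring coloring' ,
    λ i → trans (splice-left f f' (LA.xv<size i)) (f-x i)

  chain-P3 : ∀ (f : ℕ → Fin 4) → IsColoring C (splice L L') f →
             ∀ (i : Fin ℓ) → f (xv i) ≡ f (yv C ℓ ((σ ∘ₚ σ') ⟨$⟩ʳ i))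
  chain-P3 f coloring i = begin
    f (xv i)                       ≡⟨ A.P3 f (coloring-left {L' = L'} LA.wf coloring) i ⟩
    f (o + xv j)                   ≡⟨ B.P3 (f ∘ (o +_)) (coloring-shift lists-agree coloring) j ⟩
    f (o + yv G' ℓ (σ' ⟨$⟩ʳ j))    ≡⟨ cong f (sym (yv-chain LB.ℓ'≤size (σ' ⟨$⟩ʳ j))) ⟩
    f (yv C ℓ ((σ ∘ₚ σ') ⟨$⟩ʳ i))  ∎
    where
    open ≡-Reasoning
    j : Fin ℓ
    j = σ ⟨$⟩ʳ i

-- The hypothesis 0 < ℓ is already contained in Link.
mainTheorem10 : (ℓ : ℕ) → 0 < ℓ → (σ σ' : Permutation′ ℓ) →
    (G G' : OGraph) (L L' : Lists) →
    PermGadget σ G L → PermGadget σ' G' L' →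
    PermGadget (σ ∘ₚ σ') (chain ℓ G G') (chainL ℓ G L L')
mainTheorem10 ℓ _ σ σ' G G' L L' gadget gadget' = record
  { link = chain-link (PermGadget.link gadget) (PermGadget.link gadget')
  ; P1   = chain-P1
  ; P2   = chain-P2
  ; P3   = chain-P3
  }
  where open ChainGadget gadget gadget'
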